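{- Let $\mathbf P=(P,\leq,{}',0,1)$ be an orthogonal lub-complete poset. Then: (i) $\mathbf P$ is a Boolean poset (with ${}'$ as its complementation) if and only if (MPO) holds for $\rightarrow_C$ in $\mathbf P$; (ii) for each $\rightarrow\in\{\rightarrow_K,\rightarrow_N,\rightarrow_S,\rightarrow_D\}$, $\mathbf P$ is an orthomodular poset if and only if (MPO) holds for $\rightarrow$ in $\mathbf P$. Here (MPO) for an operator $\rightarrow\colon P^2\to 2^P$ is the condition: for all $x,y,u,v\in P$, if $x\leq y$ and $x\rightarrow y\leq u\rightarrow v$, then $u\leq v$.
   Context: For a poset $(P,\leq)$ and $A,B\subseteq P$: $A\leq B$ means $a\leq b$ for all $a\in A$, $b\in B$. $L(A)=\{x: x\leq a\ \forall a\in A\}$, $U(A)=\{x: a\leq x\ \forall a\in A\}$, $L(x,y)=L(\{x,y\})$, $U(x,y)=U(\{x,y\})$, $LU(A)=L(U(A))$. $\operatorname{Max}A$, $\operatorname{Min}A$: maximal/minimal elements of $A$. $x\vee y$, $x\wedge y$: supremum/infimum when they exist. A bounded poset $(P,\leq,{}',0,1)$ with antitone involution: $x\leq y\Rightarrow y'\leq x'$, $x''=x$. $x\perp y$ iff $x\leq y'$. Orthogonal: $x\perp y$ implies $x\vee y$ exists. Lub-complete: for every finite $M\subseteq P$ and lower bound $x$ of $M$ there is a maximal element of $L(M)$ above $x$. Orthomodular poset: orthogonal poset with $x\leq y\Rightarrow x\vee(y\wedge x')=y$. Boolean poset: distributive ($L(U(x,y),z)=LU(L(x,z),L(y,z))$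 for all $x,y,z$) and complemented (each $x$ has $y$ with $L(x,y)=L(P)$, $U(x,y)=U(P)$); complements are then unique and here ${}'$ is this complementation. Implications $P^2\to 2^P$: $x\rightarrow_C y=\operatorname{Min}U(x',y)$; $x\rightarrow_K y=\{(a\vee b)\vee(x\wedge c): a\in\operatorname{Max}L(x',y), b\in\operatorname{Max}L(x',y'), c\in\operatorname{Min}U(x',y)\}$; $x\rightarrow_N y=y'\rightarrow_K x'$; $x\rightarrow_S y=\{x'\vee a: a\in\operatorname{Max}L(x,y)\}$; $x\rightarrow_D y=y'\rightarrow_S x'=\{y\vee b: b\in\operatorname{Max}L(x',y')\}$ (all suprema/infima used exist in an orthogonal lub-complete poset). -}

module Defs where

open import Data.Product using (Σ; ∃; ∃-syntax; _×_; _,_)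
open import Data.Sum using (_⊎_)
open import Data.Unit using (⊤)
open import Data.List using (List)
import Data.List.Membership.Propositional as LM
open import Relation.Binary.PropositionalEquality using (_≡_)

record BoundedPosetAI : Set₁ where
  field
    Carrier  : Set
    _≤_      : Carrier → Carrier → Set
    ≤-refl   : ∀ x → x ≤ x
    ≤-antisym : ∀ {x y} → x ≤ y → y ≤ x → x ≡ y
    ≤-trans  : ∀ {x y z} → x ≤ y → y ≤ z → x ≤ z
    _′       : Carrier → Carrier
    𝟘        : Carrier
    𝟙        : Carrier
    𝟘-least  : ∀ x → 𝟘 ≤ x
    𝟙-greatest : ∀ x → x ≤ 𝟙
    ′-antitone : ∀ {x y} → x ≤ y → (y ′) ≤ (x ′)
    ′-involutive : ∀ x → ((x ′) ′) ≡ x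

module Theory (P : BoundedPosetAI) where
  open BoundedPosetAI P public

  Sub : Set₁
  Sub = Carrier → Set

  _⊆_ : Sub → Sub → Set
  A ⊆ B = ∀ x → A x → B x

  _≐_ : Sub → Sub → Set
  A ≐ B = (A ⊆ B) × (B ⊆ A)

  _∪_ : Sub → Sub → Sub
  (A ∪ B) x = A x ⊎ B x

  sing : Carrier → Sub
  sing a x = x ≡ a

  pair : Carrier → Carrier → Sub
  pair a b = sing a ∪ sing b

  whole : Sub
  whole _ = ⊤

  _≤ₛ_ : Sub → Sub → Set
  A ≤ₛ B = ∀ a b → A a → B b → a ≤ b

  L : Sub → Sub
  L A x = ∀ a → A a → x ≤ a

  U : Sub → Sub
  U A x = ∀ a → A a → a ≤ x

  L₂ : Carrier → Carrier → Sub
  L₂ x y = L (pair x y)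

  U₂ : Carrier → Carrier → Sub
  U₂ x y = U (pair x y)

  Max : Sub → Sub
  Max A x = A x × (∀ y → A y → x ≤ y → y ≡ x)

  Min : Sub → Sub
  Min A x = A x × (∀ y → A y → y ≤ x → y ≡ x)

  IsSup : Carrier → Carrier → Carrier → Set
  IsSup x y s = U₂ x y s × (∀ t → U₂ x y t → s ≤ t)

  IsInf : Carrier → Carrier → Carrier → Set
  IsInf x y m = L₂ x y m × (∀ t → L₂ x y t → t ≤ m)

  _⊥_ : Carrier → Carrier → Set
  x ⊥ y = x ≤ (y ′)

  Orthogonal : Set
  Orthogonal = ∀ x y → x ⊥ y → ∃[ s ] IsSup x y s

  LubComplete : Set
  LubComplete = ∀ (M : List Carrier) x → L (λ z → z LM.∈ M) x →
    ∃[ m ] (Max (L (λ z → z LM.∈ M)) m × (x ≤ m))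

  Orthomodular : Set
  Orthomodular = Orthogonal ×
    (∀ x y → x ≤ y → ∀ m → IsInf y (x ′) m → ∀ s → IsSup x m s → s ≡ y)

  Distributive : Set
  Distributive = ∀ x y z →
    L (U₂ x y ∪ sing z) ≐ L (U (L₂ x z ∪ L₂ y z))

  IsComplementOf : Carrier → Carrier → Set
  IsComplementOf y x = (L₂ x y ≐ L whole) × (U₂ x y ≐ U whole)

  Complemented : Set
  Complemented = ∀ x → ∃[ y ] IsComplementOf y x

  IsBoolean : Set
  IsBoolean = Distributive × Complemented × (∀ x → IsComplementOf (x ′) x)

  Op : Set₁
  Op = Carrier → Carrier → Sub

  MPO : Op → Set
  MPO _⇒_ = ∀ x y u v → x ≤ y → (x ⇒ y) ≤ₛ (u ⇒ v) → u ≤ v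

  ⇒C : Op
  ⇒C x y = Min (U₂ (x ′) y)

  -- (a ∨ b) ∨ (x ∧ c), suprema/infima given relationally
  ⇒K : Op
  ⇒K x y z = Σ Carrier λ a → Σ Carrier λ b → Σ Carrier λ c →
             Σ Carrier λ d → Σ Carrier λ e →
      Max (L₂ (x ′) y) a × Max (L₂ (x ′) (y ′)) b × Min (U₂ (x ′) y) c ×
      IsSup a b d × IsInf x c e × IsSup d e z

  ⇒N : Op
  ⇒N x y = ⇒K (y ′) (x ′)

  ⇒S : Op
  ⇒S x y z = ∃[ a ] (Max (L₂ x y) a × IsSup (x ′) a z)

  ⇒D : Op
  ⇒D x y z = ∃[ b ] (Max (L₂ (x ′) (y ′)) b × IsSup y b z)

-- Each implication takes a value above 1 at a pair x ≤ y as soon as ′ is an orthocomplementation,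
-- so in that case (MPO) says exactly that some value of u → v above 1 forces u ≤ v; in an
-- orthomodular poset this follows from the orthomodular law (for →C, from distributivity).
-- Conversely (MPO) is applied with x = y = 1: comparing x → x with 1 → (x′ ∨ x) gives x ∨ x′ = 1,
-- and since every value of y → (x ∨ (y ∧ x′)) lies above y′ and above x ∨ (y ∧ x′), the
-- orthomodular law follows; for →C the same trick shows that u ∧ v′ = 0 implies u ≤ v, which
-- yields distributivity. Finally →N and →D are the contrapositive duals of →K and →S.
module Submission where

open import Defs
open import Data.Product using (_×_; _,_; proj₁; proj₂; ∃-syntax)
open import Data.Sum using (inj₁; inj₂)
open import Data.Unit using (tt)
open import Data.List using ([]; _∷_)
open import Data.List.Membership.Propositional using (_∈_)
open import Data.List.Relation.Unary.Any using (here; there)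
open import Relation.Binary.PropositionalEquality using (_≡_; refl; sym; trans; cong; subst; subst₂)
open import Function.Bundles using (_⇔_; mk⇔)
open import Function.Properties.Equivalence using () renaming (trans to ⇔-trans)

module Properties (P : BoundedPosetAI) where
  open Theory P

  private variable
    a b c d e m s t u v x y z : Carrier
    A : Sub

  ≤-reflexive : x ≡ y → x ≤ y
  ≤-reflexive {x} refl = ≤-refl x

  ′-flipˡ : (x ′) ≤ y → (y ′) ≤ x
  ′-flipˡ x′≤y = ≤-trans (′-antitone x′≤y) (≤-reflexive (′-involutive _))

  ′-flipʳ : x ≤ (y ′) → y ≤ (x ′)
  ′-flipʳ x≤y′ = ≤-trans (≤-reflexive (sym (′-involutive _))) (′-antitone x≤y′)

  ′-cancel-≤ : (x ′) ≤ (y ′) → y ≤ x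
  ′-cancel-≤ x′≤y′ = ≤-trans (≤-reflexive (sym (′-involutive _))) (′-flipˡ x′≤y′)

  𝟙′≡𝟘 : (𝟙 ′) ≡ 𝟘
  𝟙′≡𝟘 = ≤-antisym (′-flipˡ (𝟙-greatest _)) (𝟘-least _)

  𝟙≤′⇒≤𝟘 : 𝟙 ≤ (x ′) → x ≤ 𝟘
  𝟙≤′⇒≤𝟘 𝟙≤x′ = ≤-trans (′-flipʳ 𝟙≤x′) (≤-reflexive 𝟙′≡𝟘)

  ′≤𝟘⇒𝟙≤ : (x ′) ≤ 𝟘 → 𝟙 ≤ x
  ′≤𝟘⇒𝟙≤ x′≤𝟘 = ′-cancel-≤ (≤-trans x′≤𝟘 (≤-reflexive (sym 𝟙′≡𝟘)))

  L₂-intro : t ≤ x → t ≤ y → L₂ x y t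
  L₂-intro t≤x t≤y _ (inj₁ refl) = t≤x
  L₂-intro t≤x t≤y _ (inj₂ refl) = t≤y

  L₂-≤₁ : L₂ x y t → t ≤ x
  L₂-≤₁ t∈L = t∈L _ (inj₁ refl)

  L₂-≤₂ : L₂ x y t → t ≤ y
  L₂-≤₂ t∈L = t∈L _ (inj₂ refl)

  L₂-swap : L₂ x y t → L₂ y x t
  L₂-swap t∈L = L₂-intro (L₂-≤₂ t∈L) (L₂-≤₁ t∈L)

  U₂-intro : x ≤ t → y ≤ t → U₂ x y t
  U₂-intro x≤t y≤t _ (inj₁ refl) = x≤t
  U₂-intro x≤t y≤t _ (inj₂ refl) = y≤t

  U₂-≤₁ : U₂ x y t → x ≤ t
  U₂-≤₁ t∈U = t∈U _ (inj₁ refl)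

  U₂-≤₂ : U₂ x y t → y ≤ t
  U₂-≤₂ t∈U = t∈U _ (inj₂ refl)

  IsSup-≤₁ : IsSup x y s → x ≤ s
  IsSup-≤₁ s-sup = U₂-≤₁ (proj₁ s-sup)

  IsSup-≤₂ : IsSup x y s → y ≤ s
  IsSup-≤₂ s-sup = U₂-≤₂ (proj₁ s-sup)

  IsSup-least : IsSup x y s → x ≤ t → y ≤ t → s ≤ t
  IsSup-least s-sup x≤t y≤t = proj₂ s-sup _ (U₂-intro x≤t y≤t)

  IsInf-≤₁ : IsInf x y m → m ≤ x
  IsInf-≤₁ m-inf = L₂-≤₁ (proj₁ m-inf)

  IsInf-≤₂ : IsInf x y m → m ≤ y
  IsInf-≤₂ m-inf = L₂-≤₂ (proj₁ m-inf)

  IsInf-greatest : IsInf x y m → t ≤ x → t ≤ y → t ≤ m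
  IsInf-greatest m-inf t≤x t≤y = proj₂ m-inf _ (L₂-intro t≤x t≤y)

  IsInf-of-≤ : x ≤ y → IsInf x y x
  IsInf-of-≤ {x} x≤y = L₂-intro (≤-refl x) x≤y , λ _ t∈L → L₂-≤₁ t∈L

  IsInf-of-≥ : y ≤ x → IsInf x y y
  IsInf-of-≥ {y} y≤x = L₂-intro y≤x (≤-refl y) , λ _ t∈L → L₂-≤₂ t∈L

  IsSup-′⇒IsInf : IsSup (x ′) (y ′) s → IsInf x y (s ′)
  IsSup-′⇒IsInf s-sup =
    L₂-intro (′-flipˡ (IsSup-≤₁ s-sup)) (′-flipˡ (IsSup-≤₂ s-sup)) ,
    λ t t∈L → ′-flipʳ (IsSup-least s-sup (′-flipʳ (≤-trans (L₂-≤₁ t∈L) (≤-reflexive (sym (′-involutive _)))))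
                                         (′-flipʳ (≤-trans (L₂-≤₂ t∈L) (≤-reflexive (sym (′-involutive _))))))

  IsInf⇒Max : IsInf x y m → Max (L₂ x y) m
  IsInf⇒Max m-inf = proj₁ m-inf , λ t t∈L m≤t → ≤-antisym (proj₂ m-inf t t∈L) m≤t

  Max-L₂-≡ˡ : Max (L₂ x y) a → x ≤ y → a ≡ x
  Max-L₂-≡ˡ {x} a-max x≤y = sym (proj₂ a-max x (L₂-intro (≤-refl x) x≤y) (L₂-≤₁ (proj₁ a-max)))

  Max-L₂-≡ʳ : Max (L₂ x y) a → y ≤ x → a ≡ y
  Max-L₂-≡ʳ {y = y} a-max y≤x = sym (proj₂ a-max y (L₂-intro y≤x (≤-refl y)) (L₂-≤₂ (proj₁ a-max)))

  Max-L₂-swap : Max (L₂ x y) a → Max (L₂ y x) a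
  Max-L₂-swap a-max = L₂-swap (proj₁ a-max) , λ t t∈L a≤t → proj₂ a-max t (L₂-swap t∈L) a≤t

  Min-U₂-≡ : Min (U₂ x y) c → IsSup x y s → c ≡ s
  Min-U₂-≡ c-min s-sup = sym (proj₂ c-min _ (proj₁ s-sup) (proj₂ s-sup _ (proj₁ c-min)))

  Min-𝟙 : Min A c → 𝟙 ≤ c → A t → 𝟙 ≤ t
  Min-𝟙 {t = t} c-min 𝟙≤c t∈A =
    ≤-trans 𝟙≤c (≤-reflexive (sym (proj₂ c-min t t∈A (≤-trans (𝟙-greatest t) 𝟙≤c))))

  Disjoint : Carrier → Carrier → Set
  Disjoint x y = ∀ t → t ≤ x → t ≤ y → t ≤ 𝟘

  Codisjoint : Carrier → Carrier → Set
  Codisjoint x y = ∀ t → x ≤ t → y ≤ t → 𝟙 ≤ t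

  Codisjoint-comm : Codisjoint x y → Codisjoint y x
  Codisjoint-comm cod t y≤t x≤t = cod t x≤t y≤t

  IsSup⇒Codisjoint : IsSup x y s → 𝟙 ≤ s → Codisjoint x y
  IsSup⇒Codisjoint s-sup 𝟙≤s t x≤t y≤t = ≤-trans 𝟙≤s (IsSup-least s-sup x≤t y≤t)

  Orthocomplemented : Set
  Orthocomplemented = ∀ x → Codisjoint x (x ′)

  orthocomplemented-′≤⇒𝟙≤ : Orthocomplemented → (x ′) ≤ x → 𝟙 ≤ x
  orthocomplemented-′≤⇒𝟙≤ {x} oc x′≤x = oc (x ′) x x′≤x (≤-reflexive (′-involutive x))

  orthocomplemented⇒disjoint : Orthocomplemented → ∀ x → Disjoint x (x ′)
  orthocomplemented⇒disjoint oc x t t≤x t≤x′ = 𝟙≤′⇒≤𝟘 (oc x (t ′) (′-flipʳ t≤x′) (′-antitone t≤x))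

  orthocomplemented⇒complement : Orthocomplemented → ∀ x → IsComplementOf (x ′) x
  orthocomplemented⇒complement oc x =
    ((λ t t∈L a _ → ≤-trans (orthocomplemented⇒disjoint oc x t (L₂-≤₁ t∈L) (L₂-≤₂ t∈L)) (𝟘-least a)) ,
     (λ t t∈L → L₂-intro (t∈L x tt) (t∈L (x ′) tt))) ,
    ((λ t t∈U a _ → ≤-trans (𝟙-greatest a) (oc x t (U₂-≤₁ t∈U) (U₂-≤₂ t∈U))) ,
     (λ t t∈U → U₂-intro (t∈U x tt) (t∈U (x ′) tt)))

  complement⇒codisjoint : IsComplementOf y x → Codisjoint x y
  complement⇒codisjoint y-comp t x≤t y≤t = proj₁ (proj₂ y-comp) t (U₂-intro x≤t y≤t) 𝟙 tt

  complement⇒disjoint : IsComplementOf y x → Disjoint x y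
  complement⇒disjoint y-comp t t≤x t≤y = proj₁ (proj₁ y-comp) t (L₂-intro t≤x t≤y) 𝟘 tt

  codisjoint-y′-x∨[y∧x′] : Orthocomplemented → IsInf y (x ′) m → IsSup x m s → Codisjoint (y ′) s
  codisjoint-y′-x∨[y∧x′] oc m-inf s-sup t y′≤t s≤t = orthocomplemented-′≤⇒𝟙≤ oc t′≤t
    where
    t′≤t : (t ′) ≤ t
    t′≤t = ≤-trans (IsInf-greatest m-inf (′-flipˡ y′≤t) (′-antitone (≤-trans (IsSup-≤₁ s-sup) s≤t)))
                   (≤-trans (IsSup-≤₂ s-sup) s≤t)

  IsInf-exists : Orthogonal → (x ′) ≤ y → ∃[ m ] IsInf x y m
  IsInf-exists {x} {y} orth x′≤y with orth (x ′) (y ′) (≤-trans x′≤y (≤-reflexive (sym (′-involutive y))))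
  ... | s , s-sup = s ′ , IsSup-′⇒IsInf s-sup

  Max-L₂-exists : LubComplete → ∀ x y → ∃[ m ] Max (L₂ x y) m
  Max-L₂-exists lub x y with lub (x ∷ y ∷ []) 𝟘 (λ t _ → 𝟘-least t)
  ... | m , (m∈L , m-maximal) , _ =
    m , L₂-intro (m∈L x (here refl)) (m∈L y (there (here refl))) ,
    λ t t∈L m≤t → m-maximal t (below-list t∈L) m≤t
    where
    below-list : L₂ x y t → L (_∈ x ∷ y ∷ []) t
    below-list t∈L _ (here refl) = L₂-≤₁ t∈L
    below-list t∈L _ (there (here refl)) = L₂-≤₂ t∈L

  Min-U₂-exists : LubComplete → ∀ x y → ∃[ c ] Min (U₂ x y) c
  Min-U₂-exists lub x y with Max-L₂-exists lub (x ′) (y ′)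
  ... | m , m∈L , m-maximal =
    m ′ , U₂-intro (′-flipʳ (L₂-≤₁ m∈L)) (′-flipʳ (L₂-≤₂ m∈L)) ,
    λ t t∈U t≤m′ → trans (sym (′-involutive t))
      (cong _′ (m-maximal (t ′) (L₂-intro (′-antitone (U₂-≤₁ t∈U)) (′-antitone (U₂-≤₂ t∈U))) (′-flipʳ t≤m′)))

  orthomodular⇒orthocomplemented : Orthomodular → Orthocomplemented
  orthomodular⇒orthocomplemented (orth , law) x t x≤t x′≤t
    with orth x (x ′) (≤-reflexive (sym (′-involutive x)))
  ... | s , s-sup =
    ≤-trans (≤-reflexive (sym (law x 𝟙 (𝟙-greatest x) (x ′) (IsInf-of-≥ (𝟙-greatest _)) s s-sup)))
            (IsSup-least s-sup x≤t x′≤t)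

  ≤-disjoint-′⇒≡ : Orthomodular → x ≤ y → Disjoint y (x ′) → x ≡ y
  ≤-disjoint-′⇒≡ {x} {y} (_ , law) x≤y disjoint =
    law x y x≤y 𝟘 (L₂-intro (𝟘-least _) (𝟘-least _) , λ t t∈L → disjoint t (L₂-≤₁ t∈L) (L₂-≤₂ t∈L))
        x (U₂-intro (≤-refl x) (𝟘-least x) , λ _ t∈U → U₂-≤₁ t∈U)

  ≡-of-codisjoint : Orthomodular → Codisjoint d e → d ≤ (u ′) → e ≤ u → e ≡ u
  ≡-of-codisjoint om cod d≤u′ e≤u = ≤-disjoint-′⇒≡ om e≤u λ t t≤u t≤e′ →
    𝟙≤′⇒≤𝟘 (cod (t ′) (≤-trans d≤u′ (′-antitone t≤u)) (′-flipʳ t≤e′))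

  -- The orthomodular law applied to a ≤ v gives v = a ∨ (v ∧ a′), and v ∧ a′ turns out to be u.
  codisjoint-′-split⇒≤ : Orthomodular → a ≤ v → b ≤ (v ′) → IsSup a b (u ′) → Codisjoint (u ′) v → u ≤ v
  codisjoint-′-split⇒≤ {a} {v} {u = u} om@(orth , law) a≤v b≤v′ u′-sup cod
    with IsInf-exists orth (′-antitone a≤v)
  ... | p , p-inf with IsSup-least u′-sup (′-flipʳ (IsInf-≤₂ p-inf)) (≤-trans b≤v′ (′-antitone (IsInf-≤₁ p-inf)))
  ... | u′≤p′ with orth a p (′-flipʳ (IsInf-≤₂ p-inf)) | orth (u ′) p u′≤p′
  ... | s , s-sup | r , r-sup = ≤-trans (≤-reflexive (sym p≡u)) (IsInf-≤₁ p-inf)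
    where
    v≤r : v ≤ r
    v≤r = ≤-trans (≤-reflexive (sym (law a v a≤v p p-inf s s-sup)))
                  (IsSup-least s-sup (≤-trans (IsSup-≤₁ u′-sup) (IsSup-≤₁ r-sup)) (IsSup-≤₂ r-sup))
    p≡u : p ≡ u
    p≡u = ≡-of-codisjoint om (IsSup⇒Codisjoint r-sup (cod r (IsSup-≤₁ r-sup) v≤r)) (≤-refl _) (′-cancel-≤ u′≤p′)

  MPO-intro : {_⇒_ : Op} →
    (∀ x y → ∃[ z ] (x ⇒ y) z) →
    (∀ {x y} → x ≤ y → ∃[ z ] ((x ⇒ y) z × 𝟙 ≤ z)) →
    (∀ {u v z} → (u ⇒ v) z → 𝟙 ≤ z → u ≤ v) →
    MPO _⇒_
  MPO-intro nonempty top 𝟙⇒≤ x y u v x≤y ⇒≤ₛ with top x≤y | nonempty u v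
  ... | z₀ , z₀∈ , 𝟙≤z₀ | z , z∈ = 𝟙⇒≤ z∈ (≤-trans 𝟙≤z₀ (⇒≤ₛ z₀ z z₀∈ z∈))

  MPO-≤ : {_⇒_ : Op} → MPO _⇒_ → (∀ z → (u ⇒ v) z → 𝟙 ≤ z) → u ≤ v
  MPO-≤ {u} {v} mpo all-𝟙 = mpo 𝟙 𝟙 u v (≤-refl 𝟙) λ a z _ z∈ → ≤-trans (𝟙-greatest a) (all-𝟙 z z∈)

  MPO⇒orthocomplemented : Orthogonal → {_⇒_ : Op} → MPO _⇒_ →
    (∀ {x s} → IsSup (x ′) x s → (x ⇒ x) ≤ₛ (𝟙 ⇒ s)) → Orthocomplemented
  MPO⇒orthocomplemented orth mpo x⇒x≤ₛ𝟙⇒s x t x≤t x′≤t with orth (x ′) x (≤-refl _)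
  ... | s , s-sup = ≤-trans (mpo x x 𝟙 s (≤-refl x) (x⇒x≤ₛ𝟙⇒s s-sup)) (IsSup-least s-sup x′≤t x≤t)

  MPO⇒orthomodular : Orthogonal → {_⇒_ : Op} → MPO _⇒_ → Orthocomplemented →
    (∀ {y s} → s ≤ y → (y ⇒ s) ⊆ U₂ (y ′) s) → Orthomodular
  MPO⇒orthomodular orth mpo oc bounds = orth , λ x y x≤y m m-inf s s-sup →
    let s≤y = IsSup-least s-sup x≤y (IsInf-≤₁ m-inf) in
    ≤-antisym s≤y (MPO-≤ mpo λ z z∈ →
      codisjoint-y′-x∨[y∧x′] oc m-inf s-sup z (U₂-≤₁ (bounds s≤y z z∈)) (U₂-≤₂ (bounds s≤y z z∈)))

  orthomodular⇔MPO : Orthogonal → {_⇒_ : Op} →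
    (∀ x y → ∃[ z ] (x ⇒ y) z) →
    (Orthocomplemented → ∀ {x y} → x ≤ y → ∃[ z ] ((x ⇒ y) z × 𝟙 ≤ z)) →
    (Orthomodular → ∀ {u v z} → (u ⇒ v) z → 𝟙 ≤ z → u ≤ v) →
    (∀ {x s} → IsSup (x ′) x s → (x ⇒ x) ≤ₛ (𝟙 ⇒ s)) →
    (∀ {y s} → s ≤ y → (y ⇒ s) ⊆ U₂ (y ′) s) →
    Orthomodular ⇔ MPO _⇒_
  orthomodular⇔MPO orth nonempty top 𝟙⇒≤ x⇒x≤ₛ𝟙⇒s bounds = mk⇔
    (λ om → MPO-intro nonempty (top (orthomodular⇒orthocomplemented om)) (𝟙⇒≤ om))
    (λ mpo → MPO⇒orthomodular orth mpo (MPO⇒orthocomplemented orth mpo x⇒x≤ₛ𝟙⇒s) bounds)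

  MPO-dual : {_⇒₁_ _⇒₂_ : Op} → (∀ {x y} → ((y ′) ⇒₁ (x ′)) ⊆ (x ⇒₂ y)) → MPO _⇒₁_ → MPO _⇒₂_
  MPO-dual dual mpo x y u v x≤y ⇒≤ₛ =
    ′-cancel-≤ (mpo (y ′) (x ′) (v ′) (u ′) (′-antitone x≤y) λ a b a∈ b∈ → ⇒≤ₛ a b (dual a a∈) (dual b b∈))

  MPO-dual-⇔ : {_⇒₁_ _⇒₂_ : Op} →
    (∀ {x y} → ((y ′) ⇒₁ (x ′)) ⊆ (x ⇒₂ y)) → (∀ {x y} → ((y ′) ⇒₂ (x ′)) ⊆ (x ⇒₁ y)) →
    MPO _⇒₁_ ⇔ MPO _⇒₂_
  MPO-dual-⇔ dual₁₂ dual₂₁ = mk⇔ (MPO-dual dual₁₂) (MPO-dual dual₂₁)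

  ⇒-′′ : (_⇒_ : Op) → (((x ′) ′) ⇒ ((y ′) ′)) ⊆ (x ⇒ y)
  ⇒-′′ {x} {y} _⇒_ z = subst₂ (λ p q → (p ⇒ q) z → (x ⇒ y) z) (sym (′-involutive x)) (sym (′-involutive y)) (λ z∈ → z∈)

  ⇒C-top : Orthocomplemented → x ≤ y → ⇒C x y 𝟙
  ⇒C-top {x} oc x≤y = U₂-intro (𝟙-greatest _) (𝟙-greatest _) , λ t t∈U _ →
    ≤-antisym (𝟙-greatest t) (oc x t (≤-trans x≤y (U₂-≤₂ t∈U)) (U₂-≤₁ t∈U))

  ⇒C-𝟙⇒≤ : Distributive → (∀ x → IsComplementOf (x ′) x) → ⇒C u v c → 𝟙 ≤ c → u ≤ v
  ⇒C-𝟙⇒≤ {u} {v} dist complement c-min 𝟙≤c = proj₁ (dist (u ′) v u) u u∈ v v∈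
    where
    u∈ : L (U₂ (u ′) v ∪ sing u) u
    u∈ t (inj₁ t∈U) = ≤-trans (𝟙-greatest u) (Min-𝟙 c-min 𝟙≤c t∈U)
    u∈ t (inj₂ refl) = ≤-refl u
    v∈ : U (L₂ (u ′) u ∪ L₂ v u) v
    v∈ t (inj₁ t∈L) = ≤-trans (complement⇒disjoint (complement u) t (L₂-≤₂ t∈L) (L₂-≤₁ t∈L)) (𝟘-least v)
    v∈ t (inj₂ t∈L) = L₂-≤₁ t∈L

  ⇒C-self≤ₛ𝟙⇒sup : IsSup (x ′) x s → ⇒C x x ≤ₛ ⇒C 𝟙 s
  ⇒C-self≤ₛ𝟙⇒sup s-sup a b a-min b-min = ≤-trans (≤-reflexive (Min-U₂-≡ a-min s-sup)) (U₂-≤₂ (proj₁ b-min))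

  MPO-C⇒disjoint⇒≤ : MPO ⇒C → Disjoint u (v ′) → u ≤ v
  MPO-C⇒disjoint⇒≤ mpo disjoint = MPO-≤ mpo λ z z-min →
    ′≤𝟘⇒𝟙≤ (disjoint (z ′) (′-flipˡ (U₂-≤₁ (proj₁ z-min))) (′-antitone (U₂-≤₂ (proj₁ z-min))))

  distributive-of-disjoint⇒≤ : Orthocomplemented → (∀ {u v} → Disjoint u (v ′) → u ≤ v) → Distributive
  distributive-of-disjoint⇒≤ oc disjoint⇒≤ x y z = LU-⊆ , LU-⊇
    where
    ≤-′-of-disjoint : ∀ {w r} x → r ≤ z → r ≤ (w ′) → U (L₂ x z) w → r ≤ (x ′)
    ≤-′-of-disjoint {w} x r≤z r≤w′ w∈U = disjoint⇒≤ λ q q≤r q≤x′′ →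
      orthocomplemented⇒disjoint oc w q
        (w∈U q (L₂-intro (≤-trans q≤x′′ (≤-reflexive (′-involutive x))) (≤-trans q≤r r≤z)))
        (≤-trans q≤r r≤w′)
    LU-⊆ : L (U₂ x y ∪ sing z) ⊆ L (U (L₂ x z ∪ L₂ y z))
    LU-⊆ t t∈L w w∈U = disjoint⇒≤ λ r r≤t r≤w′ →
      let r≤z = ≤-trans r≤t (t∈L z (inj₂ refl))
          r≤x′ = ≤-′-of-disjoint x r≤z r≤w′ (λ q q∈L → w∈U q (inj₁ q∈L))
          r≤y′ = ≤-′-of-disjoint y r≤z r≤w′ (λ q q∈L → w∈U q (inj₂ q∈L))
      in orthocomplemented⇒disjoint oc r r (≤-refl r)
           (≤-trans r≤t (t∈L (r ′) (inj₁ (U₂-intro (′-flipʳ r≤x′) (′-flipʳ r≤y′)))))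
    LU-⊇ : L (U (L₂ x z ∪ L₂ y z)) ⊆ L (U₂ x y ∪ sing z)
    LU-⊇ t t∈L a (inj₁ a∈U) = t∈L a λ { q (inj₁ q∈L) → ≤-trans (L₂-≤₁ q∈L) (U₂-≤₁ a∈U)
                                       ; q (inj₂ q∈L) → ≤-trans (L₂-≤₁ q∈L) (U₂-≤₂ a∈U) }
    LU-⊇ t t∈L a (inj₂ refl) = t∈L a λ { q (inj₁ q∈L) → L₂-≤₂ q∈L ; q (inj₂ q∈L) → L₂-≤₂ q∈L }

  boolean⇔MPO-C : Orthogonal → LubComplete → IsBoolean ⇔ MPO ⇒C
  boolean⇔MPO-C orth lub = mk⇔
    (λ (dist , _ , complement) →
      MPO-intro (λ x y → Min-U₂-exists lub (x ′) y)
                (λ x≤y → 𝟙 , ⇒C-top (λ x → complement⇒codisjoint (complement x)) x≤y , ≤-refl 𝟙)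
                (⇒C-𝟙⇒≤ dist complement))
    (λ mpo → let oc = MPO⇒orthocomplemented orth mpo ⇒C-self≤ₛ𝟙⇒sup in
      distributive-of-disjoint⇒≤ oc (MPO-C⇒disjoint⇒≤ mpo) ,
      (λ x → x ′ , orthocomplemented⇒complement oc x) ,
      orthocomplemented⇒complement oc)

  ⇒K-below : ⇒K x y z → (x ′) ≤ t → x ≤ t → z ≤ t
  ⇒K-below (_ , _ , _ , _ , _ , a-max , b-max , _ , d-sup , e-inf , z-sup) x′≤t x≤t =
    IsSup-least z-sup (IsSup-least d-sup (≤-trans (L₂-≤₁ (proj₁ a-max)) x′≤t) (≤-trans (L₂-≤₁ (proj₁ b-max)) x′≤t))
                      (≤-trans (IsInf-≤₁ e-inf) x≤t)

  ⇒K-above : ⇒K x y z → t ≤ x → t ≤ y → t ≤ z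
  ⇒K-above (_ , _ , _ , _ , _ , _ , _ , c-min , _ , e-inf , z-sup) t≤x t≤y =
    ≤-trans (IsInf-greatest e-inf t≤x (≤-trans t≤y (U₂-≤₂ (proj₁ c-min)))) (IsSup-≤₂ z-sup)

  ⇒K-nonempty : Orthogonal → LubComplete → ∀ x y → ∃[ z ] ⇒K x y z
  ⇒K-nonempty orth lub x y
    with Max-L₂-exists lub (x ′) y | Max-L₂-exists lub (x ′) (y ′) | Min-U₂-exists lub (x ′) y
  ... | a , a-max | b , b-max | c , c-min
    with orth a b (≤-trans (L₂-≤₂ (proj₁ a-max)) (′-flipʳ (L₂-≤₂ (proj₁ b-max))))
       | IsInf-exists orth (U₂-≤₁ (proj₁ c-min))
  ... | d , d-sup | e , e-inf
    with orth d e (≤-trans (IsSup-least d-sup (L₂-≤₁ (proj₁ a-max)) (L₂-≤₁ (proj₁ b-max))) (′-antitone (IsInf-≤₁ e-inf)))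
  ... | z , z-sup = z , a , b , c , d , e , a-max , b-max , c-min , d-sup , e-inf , z-sup

  -- For x ≤ y the element ((x′ ∧ y) ∨ y′) ∨ x of x ⇒K y is 1.
  ⇒K-top : Orthogonal → Orthocomplemented → ∀ {x y} → x ≤ y → ∃[ z ] (⇒K x y z × 𝟙 ≤ z)
  ⇒K-top orth oc {x} {y} x≤y with IsInf-exists orth (≤-trans (≤-reflexive (′-involutive x)) x≤y)
  ... | m , m-inf with orth m (y ′) (≤-trans (IsInf-≤₂ m-inf) (≤-reflexive (sym (′-involutive y))))
  ... | d , d-sup with orth d x (IsSup-least d-sup (IsInf-≤₁ m-inf) (′-antitone x≤y))
  ... | z , z-sup =
    z , (m , y ′ , 𝟙 , d , x , IsInf⇒Max m-inf , IsInf⇒Max (IsInf-of-≥ (′-antitone x≤y)) ,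
         ⇒C-top oc x≤y , d-sup , IsInf-of-≤ (𝟙-greatest x) , z-sup) ,
    orthocomplemented-′≤⇒𝟙≤ oc z′≤z
    where
    z′≤z : (z ′) ≤ z
    z′≤z = ≤-trans (IsInf-greatest m-inf (′-antitone (IsSup-≤₂ z-sup))
                                         (′-flipˡ (≤-trans (IsSup-≤₂ d-sup) (IsSup-≤₁ z-sup))))
                   (≤-trans (IsSup-≤₁ d-sup) (IsSup-≤₁ z-sup))

  ⇒K-𝟙⇒≤ : Orthomodular → ∀ {u v z} → ⇒K u v z → 𝟙 ≤ z → u ≤ v
  ⇒K-𝟙⇒≤ om {u} {v} (a , b , c , d , e , a-max , b-max , c-min , d-sup , e-inf , z-sup) 𝟙≤z =
    codisjoint-′-split⇒≤ om (L₂-≤₂ (proj₁ a-max)) (L₂-≤₂ (proj₁ b-max)) (subst (IsSup a b) d≡u′ d-sup) u′-v-codisjoint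
    where
    d-e-codisjoint : Codisjoint d e
    d-e-codisjoint = IsSup⇒Codisjoint z-sup 𝟙≤z
    d≤u′ : d ≤ (u ′)
    d≤u′ = IsSup-least d-sup (L₂-≤₁ (proj₁ a-max)) (L₂-≤₁ (proj₁ b-max))
    e≡u : e ≡ u
    e≡u = ≡-of-codisjoint om d-e-codisjoint d≤u′ (IsInf-≤₁ e-inf)
    d≡u′ : d ≡ u ′
    d≡u′ = ≡-of-codisjoint om (Codisjoint-comm d-e-codisjoint)
             (≤-trans (≤-reflexive e≡u) (≤-reflexive (sym (′-involutive u)))) d≤u′
    u≤c : u ≤ c
    u≤c = ≤-trans (≤-reflexive (sym e≡u)) (IsInf-≤₂ e-inf)
    u′-v-codisjoint : Codisjoint (u ′) v
    u′-v-codisjoint t u′≤t v≤t =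
      Min-𝟙 c-min (orthomodular⇒orthocomplemented om u c u≤c (U₂-≤₁ (proj₁ c-min))) (U₂-intro u′≤t v≤t)

  ⇒K-self≤ₛ𝟙⇒sup : IsSup (x ′) x s → ⇒K x x ≤ₛ ⇒K 𝟙 s
  ⇒K-self≤ₛ𝟙⇒sup s-sup _ _ z₁∈ z₂∈ =
    ≤-trans (⇒K-below z₁∈ (IsSup-≤₁ s-sup) (IsSup-≤₂ s-sup)) (⇒K-above z₂∈ (𝟙-greatest _) (≤-refl _))

  ⇒K-⊆-U₂ : s ≤ y → ⇒K y s ⊆ U₂ (y ′) s
  ⇒K-⊆-U₂ s≤y z z∈@(_ , _ , _ , _ , _ , _ , b-max , _ , d-sup , _ , z-sup) =
    U₂-intro (≤-trans (≤-reflexive (sym (Max-L₂-≡ˡ b-max (′-antitone s≤y))))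
                      (≤-trans (IsSup-≤₂ d-sup) (IsSup-≤₁ z-sup)))
             (⇒K-above z∈ s≤y (≤-refl _))

  ⇒S-nonempty : Orthogonal → LubComplete → ∀ x y → ∃[ z ] ⇒S x y z
  ⇒S-nonempty orth lub x y with Max-L₂-exists lub x y
  ... | a , a-max with orth (x ′) a (′-antitone (L₂-≤₁ (proj₁ a-max)))
  ... | z , z-sup = z , a , a-max , z-sup

  ⇒S-top : Orthogonal → Orthocomplemented → ∀ {x y} → x ≤ y → ∃[ z ] (⇒S x y z × 𝟙 ≤ z)
  ⇒S-top orth oc {x} x≤y with orth (x ′) x (≤-refl _)
  ... | z , z-sup = z , (x , IsInf⇒Max (IsInf-of-≤ x≤y) , z-sup) , oc x z (IsSup-≤₂ z-sup) (IsSup-≤₁ z-sup)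

  ⇒S-𝟙⇒≤ : Orthomodular → ∀ {u v z} → ⇒S u v z → 𝟙 ≤ z → u ≤ v
  ⇒S-𝟙⇒≤ om {u} (a , a-max , z-sup) 𝟙≤z = ≤-trans (≤-reflexive (sym a≡u)) (L₂-≤₂ (proj₁ a-max))
    where
    a≡u : a ≡ u
    a≡u = ≡-of-codisjoint om (IsSup⇒Codisjoint z-sup 𝟙≤z) (≤-refl _) (L₂-≤₁ (proj₁ a-max))

  ⇒S-self≤ₛ𝟙⇒sup : IsSup (x ′) x s → ⇒S x x ≤ₛ ⇒S 𝟙 s
  ⇒S-self≤ₛ𝟙⇒sup s-sup _ _ (_ , a₁-max , z₁-sup) (_ , a₂-max , z₂-sup) =
    ≤-trans (IsSup-least z₁-sup (IsSup-≤₁ s-sup) (≤-trans (L₂-≤₁ (proj₁ a₁-max)) (IsSup-≤₂ s-sup)))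
            (≤-trans (≤-reflexive (sym (Max-L₂-≡ʳ a₂-max (𝟙-greatest _)))) (IsSup-≤₂ z₂-sup))

  ⇒S-⊆-U₂ : s ≤ y → ⇒S y s ⊆ U₂ (y ′) s
  ⇒S-⊆-U₂ s≤y _ (_ , a-max , z-sup) =
    U₂-intro (IsSup-≤₁ z-sup) (≤-trans (≤-reflexive (sym (Max-L₂-≡ʳ a-max s≤y))) (IsSup-≤₂ z-sup))

  ⇒S-′⊆⇒D : ⇒S (y ′) (x ′) ⊆ ⇒D x y
  ⇒S-′⊆⇒D {y} z (a , a-max , z-sup) = a , Max-L₂-swap a-max , subst (λ w → IsSup w a z) (′-involutive y) z-sup

  ⇒D-′⊆⇒S : ⇒D (y ′) (x ′) ⊆ ⇒S x y
  ⇒D-′⊆⇒S {y} {x} _ (b , b-max , z-sup) =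
    b , Max-L₂-swap (subst₂ (λ p q → Max (L₂ p q) b) (′-involutive y) (′-involutive x) b-max) , z-sup

theorem11 : (P : BoundedPosetAI) → let open Theory P in
    Orthogonal → LubComplete →
      (IsBoolean ⇔ MPO ⇒C) ×
      (Orthomodular ⇔ MPO ⇒K) ×
      (Orthomodular ⇔ MPO ⇒N) ×
      (Orthomodular ⇔ MPO ⇒S) ×
      (Orthomodular ⇔ MPO ⇒D)
theorem11 P orth lub =
  boolean⇔MPO-C orth lub ,
  orthomodular⇔MPO-K ,
  ⇔-trans orthomodular⇔MPO-K (MPO-dual-⇔ (λ _ z∈ → z∈) (⇒-′′ ⇒K)) ,
  orthomodular⇔MPO-S ,
  ⇔-trans orthomodular⇔MPO-S (MPO-dual-⇔ ⇒S-′⊆⇒D ⇒D-′⊆⇒S)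
  where
  open Theory P
  open Properties P
  orthomodular⇔MPO-K : Orthomodular ⇔ MPO ⇒K
  orthomodular⇔MPO-K = orthomodular⇔MPO orth (⇒K-nonempty orth lub) (⇒K-top orth) ⇒K-𝟙⇒≤ ⇒K-self≤ₛ𝟙⇒sup ⇒K-⊆-U₂
  orthomodular⇔MPO-S : Orthomodular ⇔ MPO ⇒S
  orthomodular⇔MPO-S = orthomodular⇔MPO orth (⇒S-nonempty orth lub) (⇒S-top orth) ⇒S-𝟙⇒≤ ⇒S-self≤ₛ𝟙⇒sup ⇒S-⊆-U₂
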